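{- Let $\mathcal S\subseteq\mathbb S$ be finite and suppose that $\pi\in\mathbb S$ and $\theta\in\mathbb S$ each almost commute with every member of $\mathcal S$. Then there is a finite set $Y\subseteq\mathbb N$ such that for every $X\subseteq\mathbb N$, if $\pi\restriction(X\cup Y)=\theta\restriction(X\cup Y)$ then $\pi\restriction\Omega_{\mathcal S}(X)=\theta\restriction\Omega_{\mathcal S}(X)$. Moreover, if $\pi$ and $\theta$ actually commute with each member of $\mathcal S$, then $Y$ can be taken to be empty.
   Context: $\mathbb S$ is the symmetric group of $\mathbb N$. For $\pi,\pi'\in\mathbb S$, $\mathrm{NC}(\pi,\pi')=\{n:\pi(\pi'(n))\ne\pi'(\pi(n))\}$; $\pi,\pi'$ almost commute if $\mathrm{NC}(\pi,\pi')$ is finite. For $\mathcal S\subseteq\mathbb S$, $\equiv_{\mathcal S}$ is the transitive closure of the union of the equivalence relations whose classes are the orbits $\{\sigma^i(n):i\in\mathbb Z\}$ of the $\sigma\in\mathcal S$, and for $X\subseteq\mathbb N$, $\Omega_{\mathcal S}(X)$ is the smallest set containing $X$ and closed under $\equiv_{\mathcal S}$-equivalence classes (the union of the $\equiv_{\mathcal S}$-classes meeting $X$). -}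

module Defs where

open import Data.Nat using (ℕ; zero; suc)
open import Data.Integer using (ℤ; +_; -[1+_])
open import Data.List using (List)
open import Data.List.Membership.Propositional using (_∈_)
open import Data.Product using (Σ; ∃; _×_; _,_)
open import Data.Sum using (_⊎_)
open import Function using (_↔_; Inverse)
open import Relation.Binary.PropositionalEquality using (_≡_)
open import Relation.Binary.Construct.Closure.Transitive using (TransClosure)
open import Relation.Nullary using (¬_)

𝕊 : Set
𝕊 = ℕ ↔ ℕ

app : 𝕊 → ℕ → ℕ
app σ = Inverse.to σ

app⁻¹ : 𝕊 → ℕ → ℕ
app⁻¹ σ = Inverse.from σ

iter : (ℕ → ℕ) → ℕ → ℕ → ℕ
iter f zero n = n
iter f (suc k) n = f (iter f k n)

pow : 𝕊 → ℤ → ℕ → ℕ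
pow σ (+ k) n = iter (app σ) k n
pow σ -[1+ k ] n = iter (app⁻¹ σ) (suc k) n

Subset : Set₁
Subset = ℕ → Set

Finite : Subset → Set
Finite A = Σ (List ℕ) λ ys → ∀ n → A n → n ∈ ys

NC : 𝕊 → 𝕊 → Subset
NC π π' n = ¬ (app π (app π' n) ≡ app π' (app π n))

AlmostCommute : 𝕊 → 𝕊 → Set
AlmostCommute π π' = Finite (NC π π')

Commute : 𝕊 → 𝕊 → Set
Commute π π' = ∀ n → app π (app π' n) ≡ app π' (app π n)

SameOrbit : 𝕊 → ℕ → ℕ → Set
SameOrbit σ n m = ∃ λ (i : ℤ) → m ≡ pow σ i n

OrbitUnion : List 𝕊 → ℕ → ℕ → Set
OrbitUnion 𝒮 n m = Σ 𝕊 λ σ → (σ ∈ 𝒮) × SameOrbit σ n m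

_≡[_]_ : ℕ → List 𝕊 → ℕ → Set
n ≡[ 𝒮 ] m = TransClosure (OrbitUnion 𝒮) n m

Ω : List 𝕊 → Subset → Subset
Ω 𝒮 X n = X n ⊎ (Σ ℕ λ x → X x × (x ≡[ 𝒮 ] n))

AgreeOn : 𝕊 → 𝕊 → Subset → Set
AgreeOn π θ A = ∀ n → A n → app π n ≡ app θ n

_∪L_ : Subset → List ℕ → Subset
(X ∪L ys) n = X n ⊎ n ∈ ys

-- The set of points where π and θ agree is invariant under σ and σ⁻¹ away from
-- the finitely many points where π or θ fails to commute with σ: if π and θ
-- commute with σ at x, then π x = θ x iff π (σ x) = θ (σ x).  Taking Y to be the
-- exceptional points of all σ ∈ 𝒮 together with their σ-images, agreement on
-- X ∪ Y therefore propagates along every orbit step, hence to all of Ω 𝒮 X.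
-- When π and θ commute with 𝒮 there are no exceptional points.
module Submission where

open import Defs
open import Data.Nat using (ℕ; zero; suc)
open import Data.Nat.Properties using (_≟_)
open import Data.Integer using (+_; -[1+_])
open import Data.List using (List; []; _∷_; _++_; map)
open import Data.List.Membership.Propositional using (_∈_; _∉_)
open import Data.List.Membership.Propositional.Properties using (∈-++⁺ˡ; ∈-++⁺ʳ; ∈-map⁺)
open import Data.List.Membership.DecPropositional _≟_ using (_∈?_)
open import Data.List.Relation.Unary.Any using (here; there)
open import Data.Product using (Σ; _×_; _,_; proj₁; proj₂)
open import Data.Sum using (inj₁; inj₂)
open import Function using (Inverse; Injection)
open import Function.Properties.Inverse using (↔⇒↣)
open import Relation.Nullary using (yes; no)
open import Relation.Nullary.Decidable using (decidable-stable)
open import Relation.Binary.PropositionalEquality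
  using (_≡_; refl; sym; trans; cong; subst; module ≡-Reasoning)
open import Relation.Binary.Construct.Closure.Transitive using ([_]; _∷_)

Invariant : (ℕ → Set) → 𝕊 → Set
Invariant G σ = (∀ x → G x → G (app σ x)) × (∀ x → G x → G (app⁻¹ σ x))

iter-preserves : (G : ℕ → Set) (f : ℕ → ℕ) → (∀ x → G x → G (f x))
  → ∀ k x → G x → G (iter f k x)
iter-preserves G f f-pres zero    x Gx = Gx
iter-preserves G f f-pres (suc k) x Gx = f-pres _ (iter-preserves G f f-pres k x Gx)

pow-preserves : (G : ℕ → Set) (σ : 𝕊) → Invariant G σ → ∀ i x → G x → G (pow σ i x)
pow-preserves G σ (to-pres , from-pres) (+ k)    = iter-preserves G (app σ) to-pres k
pow-preserves G σ (to-pres , from-pres) -[1+ k ] = iter-preserves G (app⁻¹ σ) from-pres (suc k)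

module _ (G : ℕ → Set) {𝒮 : List 𝕊} (invariant : ∀ σ → σ ∈ 𝒮 → Invariant G σ) where

  ≡[]-preserves : ∀ {x m} → x ≡[ 𝒮 ] m → G x → G m
  ≡[]-preserves [ σ , σ∈𝒮 , i , refl ] Gx = pow-preserves G σ (invariant σ σ∈𝒮) i _ Gx
  ≡[]-preserves ((σ , σ∈𝒮 , i , refl) ∷ x≡m) Gx =
    ≡[]-preserves x≡m (pow-preserves G σ (invariant σ σ∈𝒮) i _ Gx)

  Ω-preserves : (X : Subset) → (∀ x → X x → G x) → ∀ n → Ω 𝒮 X n → G n
  Ω-preserves X X⊆G n (inj₁ Xn)             = X⊆G n Xn
  Ω-preserves X X⊆G n (inj₂ (x , Xx , x≡n)) = ≡[]-preserves x≡n (X⊆G x Xx)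

⋃-lists : {A : Set} (as : List A) (L : ∀ {a} → a ∈ as → List ℕ)
  → Σ (List ℕ) λ Y → ∀ {a} (a∈as : a ∈ as) {n} → n ∈ L a∈as → n ∈ Y
⋃-lists []       L = [] , λ ()
⋃-lists (a ∷ as) L = L (here refl) ++ proj₁ rest , covers
  where
  rest : Σ (List ℕ) λ Y → ∀ {b} (b∈as : b ∈ as) {n} → n ∈ L (there b∈as) → n ∈ Y
  rest = ⋃-lists as (λ a∈as → L (there a∈as))

  covers : ∀ {b} (b∈ : b ∈ a ∷ as) {n} → n ∈ L b∈ → n ∈ L (here refl) ++ proj₁ rest
  covers (here refl)  n∈L = ∈-++⁺ˡ n∈L
  covers (there b∈as) n∈L = ∈-++⁺ʳ (L (here refl)) (proj₂ rest b∈as n∈L)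

CommutesAt : 𝕊 → 𝕊 → ℕ → Set
CommutesAt π σ x = app π (app σ x) ≡ app σ (app π x)

commutesAt-outside : (π σ : 𝕊) (almost : AlmostCommute π σ) {x : ℕ}
  → x ∉ proj₁ almost → CommutesAt π σ x
commutesAt-outside π σ (_ , NC⊆) {x} x∉ =
  decidable-stable (app π (app σ x) ≟ app σ (app π x)) (λ nc → x∉ (NC⊆ x nc))

exceptional : (π θ σ : 𝕊) → AlmostCommute π σ → AlmostCommute θ σ → List ℕ
exceptional π θ σ almostπ almostθ = proj₁ almostπ ++ proj₁ almostθ

commutesAt-outside-exceptional : (π θ σ : 𝕊)
  (almostπ : AlmostCommute π σ) (almostθ : AlmostCommute θ σ) {x : ℕ}
  → x ∉ exceptional π θ σ almostπ almostθ → CommutesAt π σ x × CommutesAt θ σ x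
commutesAt-outside-exceptional π θ σ almostπ almostθ x∉ =
    commutesAt-outside π σ almostπ (λ x∈ → x∉ (∈-++⁺ˡ x∈))
  , commutesAt-outside θ σ almostθ (λ x∈ → x∉ (∈-++⁺ʳ _ x∈))

Agree : 𝕊 → 𝕊 → ℕ → Set
Agree π θ x = app π x ≡ app θ x

module _ (π θ σ : 𝕊) where

  agree-app : ∀ {x} → CommutesAt π σ x → CommutesAt θ σ x
    → Agree π θ x → Agree π θ (app σ x)
  agree-app {x} πσ θσ πx≡θx = begin
    app π (app σ x) ≡⟨ πσ ⟩
    app σ (app π x) ≡⟨ cong (app σ) πx≡θx ⟩
    app σ (app θ x) ≡⟨ sym θσ ⟩
    app θ (app σ x) ∎
    where open ≡-Reasoning

  agree-unapp : ∀ {x} → CommutesAt π σ x → CommutesAt θ σ x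
    → Agree π θ (app σ x) → Agree π θ x
  agree-unapp {x} πσ θσ πσx≡θσx =
    Injection.injective (↔⇒↣ σ) (trans (sym πσ) (trans πσx≡θσx θσ))

  agree-invariant : (E : List ℕ)
    → (∀ {x} → x ∉ E → CommutesAt π σ x × CommutesAt θ σ x)
    → (∀ {x} → x ∈ E → Agree π θ x × Agree π θ (app σ x))
    → Invariant (Agree π θ) σ
  agree-invariant E commute-outside agree-on-E = forward , backward
    where
    forward : ∀ x → Agree π θ x → Agree π θ (app σ x)
    forward x agree-x with x ∈? E
    ... | yes x∈E = proj₂ (agree-on-E x∈E)
    ... | no  x∉E = let πσ , θσ = commute-outside x∉E in agree-app πσ θσ agree-x

    backward : ∀ y → Agree π θ y → Agree π θ (app⁻¹ σ y)
    backward y agree-y with app⁻¹ σ y ∈? E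
    ... | yes x∈E = proj₁ (agree-on-E x∈E)
    ... | no  x∉E = let πσ , θσ = commute-outside x∉E in
      agree-unapp πσ θσ (subst (Agree π θ) (sym (Inverse.strictlyInverseˡ σ y)) agree-y)

lemma3p2 : (𝒮 : List 𝕊) (π θ : 𝕊)
    → (∀ σ → σ ∈ 𝒮 → AlmostCommute π σ)
    → (∀ σ → σ ∈ 𝒮 → AlmostCommute θ σ)
    → (Σ (List ℕ) λ Y → ∀ (X : Subset) → AgreeOn π θ (X ∪L Y) → AgreeOn π θ (Ω 𝒮 X))
    × ((∀ σ → σ ∈ 𝒮 → Commute π σ) → (∀ σ → σ ∈ 𝒮 → Commute θ σ)
    → ∀ (X : Subset) → AgreeOn π θ X → AgreeOn π θ (Ω 𝒮 X))
lemma3p2 𝒮 π θ almostπ almostθ = (Y , agree-from-X∪Y) , agree-when-commuting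
  where
  E : ∀ {σ} → σ ∈ 𝒮 → List ℕ
  E {σ} σ∈𝒮 = exceptional π θ σ (almostπ _ σ∈𝒮) (almostθ _ σ∈𝒮)

  Y-cover : Σ (List ℕ) λ Y → ∀ {σ} (σ∈𝒮 : σ ∈ 𝒮) {n} → n ∈ E σ∈𝒮 ++ map (app σ) (E σ∈𝒮) → n ∈ Y
  Y-cover = ⋃-lists 𝒮 (λ {σ} σ∈𝒮 → E σ∈𝒮 ++ map (app σ) (E σ∈𝒮))

  Y : List ℕ
  Y = proj₁ Y-cover

  agree-from-X∪Y : ∀ X → AgreeOn π θ (X ∪L Y) → AgreeOn π θ (Ω 𝒮 X)
  agree-from-X∪Y X agree = Ω-preserves (Agree π θ) invariant X (λ x Xx → agree x (inj₁ Xx))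
    where
    invariant : ∀ σ → σ ∈ 𝒮 → Invariant (Agree π θ) σ
    invariant σ σ∈𝒮 = agree-invariant π θ σ (E σ∈𝒮)
      (commutesAt-outside-exceptional π θ σ (almostπ σ σ∈𝒮) (almostθ σ σ∈𝒮))
      λ x∈E → agree _ (inj₂ (proj₂ Y-cover σ∈𝒮 (∈-++⁺ˡ x∈E)))
            , agree _ (inj₂ (proj₂ Y-cover σ∈𝒮 (∈-++⁺ʳ _ (∈-map⁺ (app σ) x∈E))))

  agree-when-commuting : (∀ σ → σ ∈ 𝒮 → Commute π σ) → (∀ σ → σ ∈ 𝒮 → Commute θ σ)
    → ∀ X → AgreeOn π θ X → AgreeOn π θ (Ω 𝒮 X)
  agree-when-commuting commπ commθ =
    Ω-preserves (Agree π θ)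
      (λ σ σ∈𝒮 → agree-invariant π θ σ [] (λ _ → commπ σ σ∈𝒮 _ , commθ σ σ∈𝒮 _) λ ())
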